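{- Given two disjoint labeled posets $P,Q$ with subsets $S\subseteq P$, $T\subseteq Q$, \[\Lambda(P,S)\Lambda(Q,T)=\sum_{u}\Lambda(u,S\cup T),\] where $u$ ranges over all chains (words) obtained by interleaving (shuffling) a word $x\in\mathcal{L}(P)$ with a word $y\in\mathcal{L}(Q)$, i.e. all words containing the letters of $x$ and $y$ such that the letters of $x$ and of $y$ each appear in their original relative order.
   Context: A labeled poset $P$ is a partial order $<_P$ on a finite subset of positive integers (which also carries the natural order $<$). Totally order the nonzero integers by $-1\prec1\prec-2\prec2\prec\cdots$. An enriched $P$-partition is a map $f$ from $P$ to the nonzero integers such that for all $x<_Py$: $f(x)\preceq f(y)$; $f(x)=f(y)>0$ implies $x<y$; $f(x)=f(y)<0$ implies $x>y$. For $S\subseteq P$, the weight of $f$ is $w(f,S)=\prod_{v\in S}x_{|f(v)|}$, and $\Lambda(P,S)=\sum_f w(f,S)$ over all enriched $P$-partitions. A chain $w_1<_P\cdots<_Pw_n$ is identified with the word $w_1\cdots w_n$, and $\mathcal{L}(P)$ is the set of linear extensions of $P$ viewed as such words (chains). For two disjoint labeled posets, chains built from their union are labeled posets with subset $S\cup T$. -}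

module Defs where

open import Level using (Level)
open import Data.Nat using (ℕ; zero; suc; _<_; _<ᵇ_; _≤ᵇ_; _≡ᵇ_)
import Data.Nat as ℕ
open import Data.Integer using (ℤ; +_; -[1+_]; ∣_∣)
open import Data.Bool using (Bool; true; false; _∧_; _∨_; not; if_then_else_)
open import Data.List using (List; []; _∷_; _++_; map; concatMap; filterᵇ; foldr)
open import Data.Bool.ListAction using (all)
open import Data.Maybe using (Maybe; just; nothing)
import Data.Maybe as Maybe
open import Algebra.Bundles using (CommutativeSemiring)
open import Data.List.Membership.Propositional using (_∈_; _∉_)
open import Data.List.Relation.Unary.All using (All)
open import Data.List.Relation.Unary.Unique.Propositional using (Unique)
open import Relation.Binary.PropositionalEquality using (_≡_)

record LabeledPoset : Set where
  field
    elems  : List ℕ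
    lt     : ℕ → ℕ → Bool
    unique : Unique elems
    pos    : All (λ a → 0 < a) elems
    irrefl : ∀ a → a ∈ elems → lt a a ≡ false
    trans  : ∀ a b c → a ∈ elems → b ∈ elems → c ∈ elems →
             lt a b ≡ true → lt b c ≡ true → lt a c ≡ true

open LabeledPoset public

-- The total order -1 ≺ 1 ≺ -2 ≺ 2 ≺ ... on nonzero integers, via the
-- order-embedding key(-k) = 2k-1, key(k) = 2k.

key : ℤ → ℕ
key (+ n)      = 2 ℕ.* n
key -[1+ n ]   = suc (2 ℕ.* n)

vals : ℕ → List ℤ
vals zero    = []
vals (suc n) = vals n ++ (-[1+ n ] ∷ + suc n ∷ [])

-- all maps from the list `es` (assumed repetition-free) to ±[N];
-- values outside `es` are irrelevant (set to 0).
assigns : ℕ → List ℕ → List (ℕ → ℤ)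
assigns N []       = (λ _ → + 0) ∷ []
assigns N (a ∷ es) =
  concatMap (λ g → map (λ v → λ z → if z ≡ᵇ a then v else g z) (vals N))
            (assigns N es)

-- conditions for f(x) = f(y):  > 0 ⇒ x < y ;  < 0 ⇒ x > y
sameOK : ℕ → ℕ → ℤ → ℤ → Bool
sameOK x y (+ m)    (+ n)    = not (m ≡ᵇ n) ∨ (x <ᵇ y)
sameOK x y -[1+ m ] -[1+ n ] = not (m ≡ᵇ n) ∨ (y <ᵇ x)
sameOK _ _ _        _        = true

isEnriched : List ℕ → (ℕ → ℕ → Bool) → (ℕ → ℤ) → Bool
isEnriched es lt f =
  all (λ x → all (λ y → not (lt x y) ∨
         ((key (f x) ≤ᵇ key (f y)) ∧ sameOK x y (f x) (f y))) es) es

-- Λ(P,S) in the variables x_1,…,x_N (i.e. enriched P-partitions with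
-- values in ±[N]), evaluated in a commutative semiring at x : ℕ → R.

module _ {c ℓ : Level} (R : CommutativeSemiring c ℓ) where
  open CommutativeSemiring R

  weight : (ℕ → Carrier) → List ℕ → (ℕ → ℤ) → Carrier
  weight x S f = foldr (λ v acc → x ∣ f v ∣ * acc) 1# S

  Λ : ℕ → (ℕ → Carrier) → List ℕ → (ℕ → ℕ → Bool) → List ℕ → Carrier
  Λ N x es lt S =
    foldr _+_ 0# (map (weight x S) (filterᵇ (isEnriched es lt) (assigns N es)))

insertions : ℕ → List ℕ → List (List ℕ)
insertions a []       = (a ∷ []) ∷ []
insertions a (b ∷ w)  = (a ∷ b ∷ w) ∷ map (b ∷_) (insertions a w)

perms : List ℕ → List (List ℕ)
perms []      = [] ∷ []
perms (a ∷ w) = concatMap (insertions a) (perms w)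

respects : (ℕ → ℕ → Bool) → List ℕ → Bool
respects lt []      = true
respects lt (a ∷ w) = all (λ b → not (lt b a)) w ∧ respects lt w

linExts : LabeledPoset → List (List ℕ)
linExts P = filterᵇ (respects (lt P)) (perms (elems P))

shuffles : List ℕ → List ℕ → List (List ℕ)
shuffles []       ys       = ys ∷ []
shuffles (x ∷ xs) []       = (x ∷ xs) ∷ []
shuffles (x ∷ xs) (y ∷ ys) =
  map (x ∷_) (shuffles xs (y ∷ ys)) ++ map (y ∷_) (shuffles (x ∷ xs) ys)

index : List ℕ → ℕ → Maybe ℕ
index []      a = nothing
index (b ∷ w) a = if a ≡ᵇ b then just 0 else Maybe.map suc (index w a)

chainLt : List ℕ → ℕ → ℕ → Bool
chainLt w a b with index w a | index w b
... | just i | just j = i <ᵇ j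
... | _      | _      = false

module _ {c ℓ : Level} (R : CommutativeSemiring c ℓ) where
  open CommutativeSemiring R

  shuffleSum : ℕ → (ℕ → Carrier) → LabeledPoset → LabeledPoset →
               List ℕ → List ℕ → Carrier
  shuffleSum N x P Q S T =
    foldr _+_ 0#
      (concatMap (λ u → Λ R N x u (chainLt u) (S ++ T) ∷ [])
        (concatMap (λ v → concatMap (λ w → shuffles v w) (linExts Q))
          (linExts P)))

module Submission where

-- An assignment f of values in ±[N] to the labels induces a strict
-- total order on labels, assignOrder f: compare the values in the order
-- -1 ≺ 1 ≺ -2 ≺ …, and order labels carrying the same value increasingly if
-- it is positive, decreasingly if it is negative.  By definition, f is an
-- enriched (es, ρ)-partition iff ρ is contained in assignOrder f on es.  So f
-- is enriched for a chain u iff u is sorted for assignOrder f, a poset has one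
-- sorted linear extension if f is enriched for it and none otherwise, and two
-- disjoint sorted words have exactly one sorted shuffle.  Hence for each f the
-- number of words u in the shuffle sum for which f is enriched is
-- [f enriched for P]·[f enriched for Q].  Writing each Λ as a sum ∑ᶠ over
-- assignments — which is independent of the order of the labels and satisfies
-- Fubini — the theorem is this pointwise identity summed over all f.

open import Defs
open import Level using (Level)
open import Data.Nat using (ℕ; zero; suc; _<_; _≟_; _≡ᵇ_; _<ᵇ_; _≤ᵇ_)
open import Data.Nat.Properties
  using (suc-injective; *-cancelˡ-≡; even≢odd; <ᵇ⇒<; <⇒<ᵇ; ≤ᵇ⇒≤; ≤⇒≤ᵇ; <⇒≤; ≤-refl;
         m≤n⇒m<n∨m≡n; <-irrefl; <-asym; <-trans; <-cmp)
open import Data.Integer using (ℤ; +_; -[1+_]; ∣_∣)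
open import Data.Bool using (Bool; true; false; _∧_; _∨_; not; if_then_else_; T; T?)
open import Data.Bool.Properties using (∧-assoc; ∧-zeroʳ; ∧-identityʳ)
open import Data.Bool.ListAction using (all)
open import Data.List using (List; []; _∷_; _++_; map; concatMap; filterᵇ; foldr; [_])
open import Data.List.Properties using (++-identityʳ; concatMap-map; concatMap-pure)
open import Data.List.Membership.Propositional using (_∈_; _∉_; find)
open import Data.List.Membership.Propositional.Properties
  using (∈-++⁻; ∈-map⁻; ∈-concatMap⁻; ∈-filter⁻)
open import Data.List.Relation.Unary.Any using (here; there)
open import Data.List.Relation.Unary.All using (All; lookup)
open import Data.List.Relation.Unary.AllPairs using (_∷_)
open import Data.List.Relation.Unary.Unique.Propositional using (Unique)
open import Data.List.Relation.Unary.Unique.Propositional.Properties using (++⁺)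
open import Data.List.Relation.Binary.Permutation.Propositional
  using (_↭_; prep; swap; ↭-sym; ↭⇒↭ₛ) renaming (refl to ↭-refl; trans to ↭-trans)
open import Data.List.Relation.Binary.Permutation.Propositional.Properties
  using (∈-resp-↭; shift; ++⁺ˡ; ++⁺ʳ)
import Data.List.Relation.Binary.Permutation.Setoid.Properties as Permₛ
open import Data.Maybe using (Maybe; just; nothing)
import Data.Maybe as Maybe
open import Data.Product using (∃; ∃₂; _×_; _,_; proj₁)
open import Data.Sum using (_⊎_; inj₁; inj₂)
open import Data.Empty using (⊥; ⊥-elim)
open import Data.Unit using (tt)
open import Function using (_∘_)
open import Relation.Nullary using (yes; no)
open import Relation.Binary.Definitions using (tri<; tri≈; tri>)
open import Relation.Binary.PropositionalEquality
  using (_≡_; _≢_; refl; sym; cong; cong₂; subst; module ≡-Reasoning)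
  renaming (trans to ≡-trans; setoid to ≡-setoid)
open import Algebra.Bundles using (CommutativeSemiring)
import Algebra.Properties.CommutativeSemigroup as CommSemigroupProperties

∧-elimˡ : ∀ {a b} → a ∧ b ≡ true → a ≡ true
∧-elimˡ {true} _ = refl

∧-elimʳ : ∀ {a b} → a ∧ b ≡ true → b ≡ true
∧-elimʳ {true} e = e

∧-intro : ∀ {a b} → a ≡ true → b ≡ true → a ∧ b ≡ true
∧-intro refl refl = refl

⇒-elim : ∀ {a b} → not a ∨ b ≡ true → a ≡ true → b ≡ true
⇒-elim e refl = e

⇒-intro : ∀ {a b} → (a ≡ true → b ≡ true) → not a ∨ b ≡ true
⇒-intro {false} _ = refl
⇒-intro {true}  h = h refl

≡-by-truth : ∀ {a b} → (a ≡ true → b ≡ true) → (b ≡ true → a ≡ true) → a ≡ b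
≡-by-truth {true}           h _ = sym (h refl)
≡-by-truth {false} {true}   _ k = k refl
≡-by-truth {false} {false}  _ _ = refl

false≢true : false ≢ true
false≢true ()

∧-swap : ∀ a b c → a ∧ (b ∧ c) ≡ b ∧ (a ∧ c)
∧-swap true  b c = refl
∧-swap false true c = refl
∧-swap false false c = refl

all-∈ : ∀ {p : ℕ → Bool} {xs x} → all p xs ≡ true → x ∈ xs → p x ≡ true
all-∈ e (here refl) = ∧-elimˡ e
all-∈ {p} {y ∷ _} e (there x∈) = all-∈ (∧-elimʳ {p y} e) x∈

∈-all : ∀ {p : ℕ → Bool} {xs} → (∀ {x} → x ∈ xs → p x ≡ true) → all p xs ≡ true
∈-all {xs = []}    _ = refl
∈-all {xs = _ ∷ _} h = ∧-intro (h (here refl)) (∈-all (h ∘ there))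

all-cong : ∀ {p q : ℕ → Bool} xs → (∀ {x} → x ∈ xs → p x ≡ q x) → all p xs ≡ all q xs
all-cong []       _ = refl
all-cong (x ∷ xs) h = cong₂ _∧_ (h (here refl)) (all-cong xs (h ∘ there))

T⇒≡true : ∀ {b} → T b → b ≡ true
T⇒≡true {true} _ = refl

≡true⇒T : ∀ {b} → b ≡ true → T b
≡true⇒T refl = tt

≡ᵇ-refl : ∀ m → (m ≡ᵇ m) ≡ true
≡ᵇ-refl zero    = refl
≡ᵇ-refl (suc m) = ≡ᵇ-refl m

≡ᵇ-true⇒≡ : ∀ m n → (m ≡ᵇ n) ≡ true → m ≡ n
≡ᵇ-true⇒≡ zero    zero    _ = refl
≡ᵇ-true⇒≡ (suc m) (suc n) e = cong suc (≡ᵇ-true⇒≡ m n e)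

≢⇒≡ᵇ-false : ∀ {m n} → m ≢ n → (m ≡ᵇ n) ≡ false
≢⇒≡ᵇ-false {zero}  {zero}  m≢n = ⊥-elim (m≢n refl)
≢⇒≡ᵇ-false {zero}  {suc n} _   = refl
≢⇒≡ᵇ-false {suc m} {zero}  _   = refl
≢⇒≡ᵇ-false {suc m} {suc n} m≢n = ≢⇒≡ᵇ-false (m≢n ∘ cong suc)

∈-shuffles⁻ : ∀ x xs y ys {u} → u ∈ shuffles (x ∷ xs) (y ∷ ys) →
  (∃ λ u′ → u′ ∈ shuffles xs (y ∷ ys) × u ≡ x ∷ u′) ⊎
  (∃ λ u′ → u′ ∈ shuffles (x ∷ xs) ys × u ≡ y ∷ u′)
∈-shuffles⁻ x xs y ys u∈ with ∈-++⁻ (map (x ∷_) (shuffles xs (y ∷ ys))) u∈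
... | inj₁ u∈ˡ = inj₁ (∈-map⁻ (x ∷_) u∈ˡ)
... | inj₂ u∈ʳ = inj₂ (∈-map⁻ (y ∷_) u∈ʳ)

shuffles-↭ : ∀ v w {u} → u ∈ shuffles v w → u ↭ v ++ w
shuffles-↭ []       w  (here refl) = ↭-refl
shuffles-↭ (x ∷ xs) [] (here refl) = subst (x ∷ xs ↭_) (sym (++-identityʳ (x ∷ xs))) ↭-refl
shuffles-↭ (x ∷ xs) (y ∷ ys) u∈ with ∈-shuffles⁻ x xs y ys u∈
... | inj₁ (u′ , u′∈ , refl) = prep x (shuffles-↭ xs (y ∷ ys) u′∈)
... | inj₂ (u′ , u′∈ , refl) =
  ↭-trans (prep y (shuffles-↭ (x ∷ xs) ys u′∈)) (↭-sym (shift y (x ∷ xs) ys))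

shuffles-all : ∀ (p : ℕ → Bool) v w {u} → u ∈ shuffles v w → all p u ≡ all p v ∧ all p w
shuffles-all p []       w  (here refl) = refl
shuffles-all p (x ∷ xs) [] (here refl) = sym (∧-identityʳ _)
shuffles-all p (x ∷ xs) (y ∷ ys) u∈ with ∈-shuffles⁻ x xs y ys u∈
... | inj₁ (u′ , u′∈ , refl) = begin
  p x ∧ all p u′                        ≡⟨ cong (p x ∧_) (shuffles-all p xs (y ∷ ys) u′∈) ⟩
  p x ∧ (all p xs ∧ all p (y ∷ ys))     ≡⟨ sym (∧-assoc (p x) _ _) ⟩
  all p (x ∷ xs) ∧ all p (y ∷ ys)       ∎
  where open ≡-Reasoning
... | inj₂ (u′ , u′∈ , refl) = begin
  p y ∧ all p u′                        ≡⟨ cong (p y ∧_) (shuffles-all p (x ∷ xs) ys u′∈) ⟩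
  p y ∧ (all p (x ∷ xs) ∧ all p ys)     ≡⟨ ∧-swap (p y) (all p (x ∷ xs)) (all p ys) ⟩
  all p (x ∷ xs) ∧ all p (y ∷ ys)       ∎
  where open ≡-Reasoning

insertions≡shuffles : ∀ a w → insertions a w ≡ shuffles (a ∷ []) w
insertions≡shuffles a []      = refl
insertions≡shuffles a (b ∷ w) = cong (λ us → (a ∷ b ∷ w) ∷ map (b ∷_) us) (insertions≡shuffles a w)

perms-↭ : ∀ es {u} → u ∈ perms es → u ↭ es
perms-↭ [] (here refl) = ↭-refl
perms-↭ (a ∷ es) u∈ with find (∈-concatMap⁻ (insertions a) u∈)
... | w , w∈ , u∈ins =
  ↭-trans (shuffles-↭ (a ∷ []) w (subst (_ ∈_) (insertions≡shuffles a w) u∈ins))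
          (prep a (perms-↭ es w∈))

Unique-↭ : ∀ {xs ys : List ℕ} → xs ↭ ys → Unique xs → Unique ys
Unique-↭ p = Permₛ.Unique-resp-↭ (≡-setoid ℕ) (↭⇒↭ₛ p)

shuffleAll : List (List ℕ) → List (List ℕ) → List (List ℕ)
shuffleAll Ls Ms = concatMap (λ v → concatMap (λ w → shuffles v w) Ms) Ls

∈-shuffleAll⁻ : ∀ {Ls Ms u} → u ∈ shuffleAll Ls Ms →
  ∃₂ λ v w → v ∈ Ls × w ∈ Ms × u ∈ shuffles v w
∈-shuffleAll⁻ {Ls} {Ms} u∈ with find (∈-concatMap⁻ (λ v → concatMap (λ w → shuffles v w) Ms) {Ls} u∈)
... | v , v∈ , u∈v with find (∈-concatMap⁻ (λ w → shuffles v w) {Ms} u∈v)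
... | w , w∈ , u∈vw = v , w , v∈ , w∈ , u∈vw

sorted : (ℕ → ℕ → Bool) → List ℕ → Bool
sorted σ []      = true
sorted σ (a ∷ w) = all (σ a) w ∧ sorted σ w

Compatible : (ρ σ : ℕ → ℕ → Bool) → List ℕ → Set
Compatible ρ σ L = ∀ {a b} → a ∈ L → b ∈ L → ρ a b ≡ true → σ a b ≡ true

-- The Boolean test for Compatible; isEnriched is an instance of it.
compatible? : (ρ σ : ℕ → ℕ → Bool) → List ℕ → Bool
compatible? ρ σ L = all (λ a → all (λ b → not (ρ a b) ∨ σ a b) L) L

compatible?⇒ : ∀ {ρ σ L} → compatible? ρ σ L ≡ true → Compatible ρ σ L
compatible?⇒ {ρ} {σ} e {a} {b} a∈ b∈ = ⇒-elim {ρ a b} (all-∈ (all-∈ e a∈) b∈)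

⇒compatible? : ∀ {ρ σ L} → Compatible ρ σ L → compatible? ρ σ L ≡ true
⇒compatible? h = ∈-all (λ a∈ → ∈-all (λ b∈ → ⇒-intro (h a∈ b∈)))

Compatible-↭ : ∀ {ρ σ L L′} → L ↭ L′ → Compatible ρ σ L → Compatible ρ σ L′
Compatible-↭ p h a∈ b∈ = h (∈-resp-↭ (↭-sym p) a∈) (∈-resp-↭ (↭-sym p) b∈)

before : Maybe ℕ → Maybe ℕ → Bool
before (just i) (just j) = i <ᵇ j
before _        _        = false

chainLt-before : ∀ w a b → chainLt w a b ≡ before (index w a) (index w b)
chainLt-before w a b with index w a | index w b
... | just _  | just _  = refl
... | just _  | nothing = refl
... | nothing | _       = refl

index-head : ∀ a w → index (a ∷ w) a ≡ just 0
index-head a w rewrite ≡ᵇ-refl a = refl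

index-tail : ∀ {a x} w → x ≢ a → index (a ∷ w) x ≡ Maybe.map suc (index w x)
index-tail w x≢a rewrite ≢⇒≡ᵇ-false x≢a = refl

index-∈ : ∀ {x w} → x ∈ w → ∃ λ j → index w x ≡ just j
index-∈ {x} {_ ∷ w} (here refl) = 0 , index-head x w
index-∈ {x} {b ∷ w} (there x∈) with x ≡ᵇ b
... | true  = 0 , refl
... | false with index-∈ x∈
...   | j , eq rewrite eq = suc j , refl

chainLt-head : ∀ {a y w} → y ∈ w → y ≢ a → chainLt (a ∷ w) a y ≡ true
chainLt-head {a} {y} {w} y∈ y≢a with index-∈ y∈
... | j , eq rewrite chainLt-before (a ∷ w) a y | index-head a w | index-tail w y≢a | eq = refl

chainLt-last : ∀ a x w → chainLt (a ∷ w) x a ≡ false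
chainLt-last a x w rewrite chainLt-before (a ∷ w) x a | index-head a w = below-0 (index (a ∷ w) x)
  where
  below-0 : ∀ m → before m (just 0) ≡ false
  below-0 (just _) = refl
  below-0 nothing  = refl

chainLt-tail : ∀ {a x y} w → x ≢ a → y ≢ a → chainLt (a ∷ w) x y ≡ chainLt w x y
chainLt-tail {a} {x} {y} w x≢a y≢a
  rewrite chainLt-before (a ∷ w) x y | chainLt-before w x y | index-tail w x≢a | index-tail w y≢a
  = before-suc (index w x) (index w y)
  where
  before-suc : ∀ m n → before (Maybe.map suc m) (Maybe.map suc n) ≡ before m n
  before-suc (just _) (just _) = refl
  before-suc (just _) nothing  = refl
  before-suc nothing  _        = refl

chain-compatible⇒sorted : ∀ {σ u} → Unique u → Compatible (chainLt u) σ u → sorted σ u ≡ true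
chain-compatible⇒sorted {u = []} _ _ = refl
chain-compatible⇒sorted {σ} {a ∷ w} (a∉ ∷ uw) h =
  ∧-intro (∈-all (λ y∈ → h (here refl) (there y∈) (chainLt-head y∈ (≢a y∈))))
          (chain-compatible⇒sorted uw λ x∈ y∈ xy →
             h (there x∈) (there y∈) (subst (_≡ true) (sym (chainLt-tail w (≢a x∈) (≢a y∈))) xy))
  where
  ≢a : ∀ {y} → y ∈ w → y ≢ a
  ≢a y∈ refl = lookup a∉ y∈ refl

sorted⇒chain-compatible : ∀ {σ u} → Unique u → sorted σ u ≡ true → Compatible (chainLt u) σ u
sorted⇒chain-compatible {u = a ∷ w} _ s (here refl) (here refl) aa =
  ⊥-elim (false≢true (subst (_≡ true) (chainLt-last a a w) aa))
sorted⇒chain-compatible {u = a ∷ w} _ s (here refl) (there y∈) _ = all-∈ (∧-elimˡ s) y∈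
sorted⇒chain-compatible {u = a ∷ w} _ s {x} (there x∈) (here refl) xa =
  ⊥-elim (false≢true (subst (_≡ true) (chainLt-last a x w) xa))
sorted⇒chain-compatible {σ} {a ∷ w} (a∉ ∷ uw) s (there x∈) (there y∈) xy =
  sorted⇒chain-compatible uw (∧-elimʳ {all (σ a) w} s) x∈ y∈
    (subst (_≡ true) (chainLt-tail w (≢a x∈) (≢a y∈)) xy)
  where
  ≢a : ∀ {y} → y ∈ w → y ≢ a
  ≢a y∈ refl = lookup a∉ y∈ refl

compatible?-chain : ∀ {σ u} → Unique u → compatible? (chainLt u) σ u ≡ sorted σ u
compatible?-chain uu =
  ≡-by-truth (chain-compatible⇒sorted uu ∘ compatible?⇒) (⇒compatible? ∘ sorted⇒chain-compatible uu)

respects⇒compatible : ∀ {ρ σ v} → (∀ {a} → a ∈ v → ρ a a ≡ false) →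
  sorted σ v ≡ true → respects ρ v ≡ true → Compatible ρ σ v
respects⇒compatible {v = a ∷ w} irr s r (here refl) (here refl) aa =
  ⊥-elim (false≢true (subst (_≡ true) (irr (here refl)) aa))
respects⇒compatible {v = a ∷ w} irr s r (here refl) (there b∈) _ = all-∈ (∧-elimˡ s) b∈
respects⇒compatible {v = a ∷ w} irr s r (there x∈) (here refl) xa =
  ⊥-elim (false≢true (subst (λ t → not t ≡ true) xa (all-∈ (∧-elimˡ r) x∈)))
respects⇒compatible {ρ} {σ} {a ∷ w} irr s r (there x∈) (there y∈) =
  respects⇒compatible (irr ∘ there) (∧-elimʳ {all (σ a) w} s)
    (∧-elimʳ {all (λ b → not (ρ b a)) w} r) x∈ y∈

compatible⇒respects : ∀ {ρ σ v} → (∀ {a b} → σ a b ≡ true → σ b a ≡ true → ⊥) →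
  sorted σ v ≡ true → Compatible ρ σ v → respects ρ v ≡ true
compatible⇒respects {v = []} _ _ _ = refl
compatible⇒respects {ρ} {σ} {a ∷ w} asym s h =
  ∧-intro (∈-all not-below)
          (compatible⇒respects asym (∧-elimʳ {all (σ a) w} s) (λ x∈ y∈ → h (there x∈) (there y∈)))
  where
  not-below : ∀ {b} → b ∈ w → not (ρ b a) ≡ true
  not-below {b} b∈ with ρ b a in ba
  ... | false = refl
  ... | true  = ⊥-elim (asym (all-∈ (∧-elimˡ s) b∈) (h (there b∈) (here refl) ba))

linExt-sorted : ∀ {ρ σ es v} → (∀ {a b} → σ a b ≡ true → σ b a ≡ true → ⊥) →
  (∀ {a} → a ∈ es → ρ a a ≡ false) → v ↭ es →
  respects ρ v ∧ sorted σ v ≡ compatible? ρ σ es ∧ sorted σ v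
linExt-sorted {ρ} {σ} {es} {v} asym irr v↭es with sorted σ v in s
... | false = ≡-trans (∧-zeroʳ _) (sym (∧-zeroʳ _))
... | true  = ≡-trans (∧-identityʳ _) (≡-trans (≡-by-truth to from) (sym (∧-identityʳ _)))
  where
  to : respects ρ v ≡ true → compatible? ρ σ es ≡ true
  to r = ⇒compatible? {ρ} {σ} (Compatible-↭ v↭es
           (respects⇒compatible (irr ∘ ∈-resp-↭ v↭es) s r))
  from : compatible? ρ σ es ≡ true → respects ρ v ≡ true
  from c = compatible⇒respects asym s (Compatible-↭ (↭-sym v↭es) (compatible?⇒ {ρ} {σ} c))

key-injective : ∀ {u v} → key u ≡ key v → u ≡ v
key-injective {+ m}      {+ n}      e = cong +_ (*-cancelˡ-≡ m n 2 e)
key-injective {+ m}      { -[1+ n ]} e = ⊥-elim (even≢odd m n e)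
key-injective { -[1+ m ]} {+ n}      e = ⊥-elim (even≢odd n m (sym e))
key-injective { -[1+ m ]} { -[1+ n ]} e = cong -[1+_] (*-cancelˡ-≡ m n 2 (suc-injective e))

tie : ℤ → ℕ → ℕ → Bool
tie (+ _)    x y = x <ᵇ y
tie -[1+ _ ] x y = y <ᵇ x

<ᵇ-true⇒< : ∀ m n → (m <ᵇ n) ≡ true → m < n
<ᵇ-true⇒< m n e = <ᵇ⇒< m n (≡true⇒T e)

<⇒<ᵇ-true : ∀ {m n} → m < n → (m <ᵇ n) ≡ true
<⇒<ᵇ-true = T⇒≡true ∘ <⇒<ᵇ

tie-asym : ∀ u x y → tie u x y ≡ true → tie u y x ≡ true → ⊥
tie-asym (+ _)    x y xy yx = <-asym (<ᵇ-true⇒< x y xy) (<ᵇ-true⇒< y x yx)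
tie-asym -[1+ _ ] x y xy yx = <-asym (<ᵇ-true⇒< y x xy) (<ᵇ-true⇒< x y yx)

tie-trans : ∀ u x y z → tie u x y ≡ true → tie u y z ≡ true → tie u x z ≡ true
tie-trans (+ _)    x y z xy yz = <⇒<ᵇ-true (<-trans (<ᵇ-true⇒< x y xy) (<ᵇ-true⇒< y z yz))
tie-trans -[1+ _ ] x y z xy yz = <⇒<ᵇ-true (<-trans (<ᵇ-true⇒< z y yz) (<ᵇ-true⇒< y x xy))

tie-total : ∀ u x y → x ≢ y → tie u x y ≡ false → tie u y x ≡ true
tie-total u x y x≢y xy with <-cmp x y
tie-total (+ _)    x y x≢y xy | tri< x<y _ _ = ⊥-elim (false≢true (≡-trans (sym xy) (<⇒<ᵇ-true x<y)))
tie-total -[1+ _ ] x y x≢y xy | tri< x<y _ _ = <⇒<ᵇ-true x<y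
tie-total u        x y x≢y xy | tri≈ _ x≡y _ = ⊥-elim (x≢y x≡y)
tie-total (+ _)    x y x≢y xy | tri> _ _ y<x = <⇒<ᵇ-true y<x
tie-total -[1+ _ ] x y x≢y xy | tri> _ _ y<x = ⊥-elim (false≢true (≡-trans (sym xy) (<⇒<ᵇ-true y<x)))

sameOK-≢ : ∀ x y {u v} → u ≢ v → sameOK x y u v ≡ true
sameOK-≢ x y {+ m}      {+ n}      u≢v rewrite ≢⇒≡ᵇ-false (u≢v ∘ cong +_) = refl
sameOK-≢ x y {+ m}      { -[1+ n ]} _  = refl
sameOK-≢ x y { -[1+ m ]} {+ n}      _  = refl
sameOK-≢ x y { -[1+ m ]} { -[1+ n ]} u≢v rewrite ≢⇒≡ᵇ-false (u≢v ∘ cong -[1+_]) = refl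

sameOK-≡ : ∀ x y u → sameOK x y u u ≡ tie u x y
sameOK-≡ x y (+ m)      rewrite ≡ᵇ-refl m = refl
sameOK-≡ x y -[1+ m ]   rewrite ≡ᵇ-refl m = refl

-- The condition an enriched P-partition f imposes along x <_P y, as a
-- relation between the labelled values (x , f x) and (y , f y).
labelledLt : ℕ → ℕ → ℤ → ℤ → Bool
labelledLt x y u v = (key u ≤ᵇ key v) ∧ sameOK x y u v

labelledLt⇒ : ∀ x y u v → labelledLt x y u v ≡ true →
  key u < key v ⊎ (u ≡ v × tie u x y ≡ true)
labelledLt⇒ x y u v e with m≤n⇒m<n∨m≡n (≤ᵇ⇒≤ (key u) (key v) (≡true⇒T (∧-elimˡ e)))
... | inj₁ ku<kv = inj₁ ku<kv
... | inj₂ ku≡kv with key-injective {u} {v} ku≡kv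
...   | refl = inj₂ (refl , ≡-trans (sym (sameOK-≡ x y u)) (∧-elimʳ {key u ≤ᵇ key u} e))

<⇒labelledLt : ∀ x y u v → key u < key v → labelledLt x y u v ≡ true
<⇒labelledLt x y u v ku<kv =
  ∧-intro (T⇒≡true (≤⇒≤ᵇ (<⇒≤ ku<kv))) (sameOK-≢ x y {u} {v} λ { refl → <-irrefl refl ku<kv })

tie⇒labelledLt : ∀ x y u → tie u x y ≡ true → labelledLt x y u u ≡ true
tie⇒labelledLt x y u t = ∧-intro (T⇒≡true (≤⇒≤ᵇ (≤-refl {key u}))) (≡-trans (sameOK-≡ x y u) t)

labelledLt-asym : ∀ x y u v → labelledLt x y u v ≡ true → labelledLt y x v u ≡ true → ⊥
labelledLt-asym x y u v xy yx with labelledLt⇒ x y u v xy | labelledLt⇒ y x v u yx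
... | inj₁ ku<kv        | inj₁ kv<ku        = <-asym ku<kv kv<ku
... | inj₁ ku<kv        | inj₂ (refl , _)   = <-irrefl refl ku<kv
... | inj₂ (refl , _)   | inj₁ kv<ku        = <-irrefl refl kv<ku
... | inj₂ (refl , txy) | inj₂ (_ , tyx)    = tie-asym u x y txy tyx

labelledLt-trans : ∀ x y z u v w → labelledLt x y u v ≡ true → labelledLt y z v w ≡ true →
  labelledLt x z u w ≡ true
labelledLt-trans x y z u v w xy yz with labelledLt⇒ x y u v xy | labelledLt⇒ y z v w yz
... | inj₁ ku<kv        | inj₁ kv<kw        = <⇒labelledLt x z u w (<-trans ku<kv kv<kw)
... | inj₁ ku<kv        | inj₂ (refl , _)   = <⇒labelledLt x z u w ku<kv
... | inj₂ (refl , _)   | inj₁ kv<kw        = <⇒labelledLt x z u w kv<kw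
... | inj₂ (refl , txy) | inj₂ (refl , tyz) = tie⇒labelledLt x z u (tie-trans u x y z txy tyz)

labelledLt-total : ∀ x y u v → x ≢ y → labelledLt x y u v ≡ false → labelledLt y x v u ≡ true
labelledLt-total x y u v x≢y xy with <-cmp (key u) (key v)
... | tri< ku<kv _ _ = ⊥-elim (false≢true (≡-trans (sym xy) (<⇒labelledLt x y u v ku<kv)))
... | tri> _ _ kv<ku = <⇒labelledLt y x v u kv<ku
... | tri≈ _ ku≡kv _ with key-injective {u} {v} ku≡kv
...   | refl with tie u x y in t
...     | true  = ⊥-elim (false≢true (≡-trans (sym xy) (tie⇒labelledLt x y u t)))
...     | false = tie⇒labelledLt y x u (tie-total u x y x≢y t)

-- The order on labels induced by an assignment f.  isEnriched es ρ f is by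
-- definition compatible? ρ (assignOrder f) es: f is enriched iff ρ ⊆ assignOrder f.
assignOrder : (ℕ → ℤ) → ℕ → ℕ → Bool
assignOrder f x y = labelledLt x y (f x) (f y)

assignOrder-asym : ∀ f {x y} → assignOrder f x y ≡ true → assignOrder f y x ≡ true → ⊥
assignOrder-asym f {x} {y} = labelledLt-asym x y (f x) (f y)

assignOrder-trans : ∀ f {x y z} → assignOrder f x y ≡ true → assignOrder f y z ≡ true →
  assignOrder f x z ≡ true
assignOrder-trans f {x} {y} {z} = labelledLt-trans x y z (f x) (f y) (f z)

assignOrder-total : ∀ f {x y} → x ≢ y → assignOrder f x y ≡ false → assignOrder f y x ≡ true
assignOrder-total f {x} {y} = labelledLt-total x y (f x) (f y)

module Sums {c ℓ : Level} (𝓡 : CommutativeSemiring c ℓ) where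
  open CommutativeSemiring 𝓡
    renaming (refl to ≈-refl; sym to ≈-sym; trans to ≈-trans; reflexive to ≈-reflexive)
  open import Relation.Binary.Reasoning.Setoid setoid
  open CommSemigroupProperties +-commutativeSemigroup using () renaming (interchange to +-interchange)

  ∑ : {A : Set} → (A → Carrier) → List A → Carrier
  ∑ g L = foldr _+_ 0# (map g L)

  ∑-cong : ∀ {A : Set} {g h : A → Carrier} L → (∀ {a} → a ∈ L → g a ≈ h a) → ∑ g L ≈ ∑ h L
  ∑-cong []      _ = ≈-refl
  ∑-cong (a ∷ L) e = +-cong (e (here refl)) (∑-cong L (e ∘ there))

  ∑-cong′ : ∀ {A : Set} {g h : A → Carrier} L → (∀ a → g a ≈ h a) → ∑ g L ≈ ∑ h L
  ∑-cong′ L e = ∑-cong L (λ {a} _ → e a)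

  ∑-++ : ∀ {A : Set} (g : A → Carrier) xs ys → ∑ g (xs ++ ys) ≈ ∑ g xs + ∑ g ys
  ∑-++ g []       ys = ≈-sym (+-identityˡ _)
  ∑-++ g (a ∷ xs) ys = ≈-trans (+-congˡ (∑-++ g xs ys)) (≈-sym (+-assoc _ _ _))

  ∑-map : ∀ {A B : Set} (g : B → Carrier) (h : A → B) xs → ∑ g (map h xs) ≈ ∑ (g ∘ h) xs
  ∑-map g h []       = ≈-refl
  ∑-map g h (a ∷ xs) = +-congˡ (∑-map g h xs)

  ∑-concatMap : ∀ {A B : Set} (g : B → Carrier) (h : A → List B) xs →
    ∑ g (concatMap h xs) ≈ ∑ (λ a → ∑ g (h a)) xs
  ∑-concatMap g h []       = ≈-refl
  ∑-concatMap g h (a ∷ xs) = ≈-trans (∑-++ g (h a) (concatMap h xs)) (+-congˡ (∑-concatMap g h xs))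

  ∑-zero : ∀ {A : Set} (xs : List A) → ∑ (λ _ → 0#) xs ≈ 0#
  ∑-zero []       = ≈-refl
  ∑-zero (a ∷ xs) = ≈-trans (+-identityˡ _) (∑-zero xs)

  ∑-+ : ∀ {A : Set} (g h : A → Carrier) xs → ∑ (λ a → g a + h a) xs ≈ ∑ g xs + ∑ h xs
  ∑-+ g h []       = ≈-sym (+-identityˡ _)
  ∑-+ g h (a ∷ xs) = ≈-trans (+-congˡ (∑-+ g h xs)) (+-interchange _ _ _ _)

  ∑-*ˡ : ∀ {A : Set} (k : Carrier) (g : A → Carrier) xs → ∑ (λ a → k * g a) xs ≈ k * ∑ g xs
  ∑-*ˡ k g []       = ≈-sym (zeroʳ k)
  ∑-*ˡ k g (a ∷ xs) = ≈-trans (+-congˡ (∑-*ˡ k g xs)) (≈-sym (distribˡ k (g a) _))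

  ∑-*ʳ : ∀ {A : Set} (k : Carrier) (g : A → Carrier) xs → ∑ (λ a → g a * k) xs ≈ ∑ g xs * k
  ∑-*ʳ k g []       = ≈-sym (zeroˡ k)
  ∑-*ʳ k g (a ∷ xs) = ≈-trans (+-congˡ (∑-*ʳ k g xs)) (≈-sym (distribʳ k (g a) _))

  ∑-swap : ∀ {A B : Set} (g : A → B → Carrier) xs ys →
    ∑ (λ a → ∑ (g a) ys) xs ≈ ∑ (λ b → ∑ (λ a → g a b) xs) ys
  ∑-swap g []       ys = ≈-sym (∑-zero ys)
  ∑-swap g (a ∷ xs) ys = ≈-trans (+-congˡ (∑-swap g xs ys)) (≈-sym (∑-+ (g a) _ ys))

  𝟙 : Bool → Carrier
  𝟙 b = if b then 1# else 0#

  𝟙-∧ : ∀ a b → 𝟙 (a ∧ b) ≈ 𝟙 a * 𝟙 b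
  𝟙-∧ true  b = ≈-sym (*-identityˡ _)
  𝟙-∧ false b = ≈-sym (zeroˡ _)

  ∑-filter : ∀ {A : Set} (h : A → Carrier) (p : A → Bool) L →
    ∑ h (filterᵇ p L) ≈ ∑ (λ a → 𝟙 (p a) * h a) L
  ∑-filter h p []      = ≈-refl
  ∑-filter h p (a ∷ L) with p a
  ... | true  = +-cong (≈-sym (*-identityˡ _)) (∑-filter h p L)
  ... | false = ≈-trans (∑-filter h p L) (≈-sym (≈-trans (+-congʳ (zeroˡ _)) (+-identityˡ _)))

  module SortedCount (_≺_ : ℕ → ℕ → Bool)
    (≺-asym  : ∀ {a b} → a ≺ b ≡ true → b ≺ a ≡ true → ⊥)
    (≺-trans : ∀ {a b c} → a ≺ b ≡ true → b ≺ c ≡ true → a ≺ c ≡ true)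
    (≺-total : ∀ {a b} → a ≢ b → a ≺ b ≡ false → b ≺ a ≡ true) where

    all-≺-trans : ∀ {x y} w → x ≺ y ≡ true → all (y ≺_) w ≡ true → all (x ≺_) w ≡ true
    all-≺-trans {x} {y} w xy yw = ∈-all {x ≺_} {w} (λ z∈ → ≺-trans xy (all-∈ {y ≺_} yw z∈))

    -- The shuffles of x ∷ xs and y ∷ ys split into the block of those starting
    -- with x and the block of those starting with y; x-block and y-block are
    -- the conditions for the respective block to contain a sorted word.
    x-block y-block : ℕ → List ℕ → ℕ → List ℕ → Bool
    x-block x xs y ys =
      (all (x ≺_) xs ∧ all (x ≺_) (y ∷ ys)) ∧ (sorted _≺_ xs ∧ sorted _≺_ (y ∷ ys))
    y-block x xs y ys =
      (all (y ≺_) (x ∷ xs) ∧ all (y ≺_) ys) ∧ (sorted _≺_ (x ∷ xs) ∧ sorted _≺_ ys)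

    blocks : ∀ x xs y ys → x ≢ y →
      let both = sorted _≺_ (x ∷ xs) ∧ sorted _≺_ (y ∷ ys) in
      (x-block x xs y ys ≡ both × y-block x xs y ys ≡ false) ⊎
      (x-block x xs y ys ≡ false × y-block x xs y ys ≡ both)
    blocks x xs y ys x≢y with x ≺ y in xy | y ≺ x in yx
    ... | true  | true  = ⊥-elim (≺-asym xy yx)
    ... | false | false = ⊥-elim (false≢true (≡-trans (sym yx) (≺-total x≢y xy)))
    ... | true  | false =
      inj₁ (absorb (all (x ≺_) xs) (sorted _≺_ xs) _ (all (y ≺_) ys) (sorted _≺_ ys) (all-≺-trans ys xy)
           , refl)
      where
      absorb : ∀ a b c d e → (d ≡ true → c ≡ true) → (a ∧ c) ∧ (b ∧ (d ∧ e)) ≡ (a ∧ b) ∧ (d ∧ e)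
      absorb a b c false e _ rewrite ∧-zeroʳ b | ∧-zeroʳ (a ∧ c) | ∧-zeroʳ (a ∧ b) = refl
      absorb a b c true  e h rewrite h refl | ∧-identityʳ a = sym (∧-assoc a b e)
    ... | false | true  =
      inj₂ ( cong (_∧ _) (∧-zeroʳ (all (x ≺_) xs))
           , absorb (all (x ≺_) xs) (all (y ≺_) xs) (sorted _≺_ xs) (all (y ≺_) ys) (sorted _≺_ ys)
                    (all-≺-trans xs yx))
      where
      absorb : ∀ a a′ b d e → (a ≡ true → a′ ≡ true) → (a′ ∧ d) ∧ ((a ∧ b) ∧ e) ≡ (a ∧ b) ∧ (d ∧ e)
      absorb false a′ b d e _ rewrite ∧-zeroʳ (a′ ∧ d) = refl
      absorb true  a′ b d e h rewrite h refl = ∧-swap d b e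

    #sorted : List (List ℕ) → Carrier
    #sorted = ∑ (𝟙 ∘ sorted _≺_)

    #sorted-cons : ∀ x k L → (∀ {u} → u ∈ L → all (x ≺_) u ≡ k) →
      #sorted (map (x ∷_) L) ≈ 𝟙 k * #sorted L
    #sorted-cons x k L h = begin
      #sorted (map (x ∷_) L)
        ≈⟨ ∑-map _ _ L ⟩
      ∑ (λ u → 𝟙 (all (x ≺_) u ∧ sorted _≺_ u)) L
        ≈⟨ ∑-cong L (λ u∈ → ≈-reflexive (cong (λ b → 𝟙 (b ∧ _)) (h u∈))) ⟩
      ∑ (λ u → 𝟙 (k ∧ sorted _≺_ u)) L
        ≈⟨ ∑-cong′ L (λ u → 𝟙-∧ k _) ⟩
      ∑ (λ u → 𝟙 k * 𝟙 (sorted _≺_ u)) L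
        ≈⟨ ∑-*ˡ _ _ L ⟩
      𝟙 k * #sorted L ∎

    #sorted-shuffles : ∀ v w → (∀ {z} → z ∈ v → z ∉ w) →
      #sorted (shuffles v w) ≈ 𝟙 (sorted _≺_ v ∧ sorted _≺_ w)
    #sorted-shuffles []       w  _ = +-identityʳ _
    #sorted-shuffles (x ∷ xs) [] _ =
      ≈-trans (+-identityʳ _) (≈-reflexive (cong 𝟙 (sym (∧-identityʳ _))))
    #sorted-shuffles (x ∷ xs) (y ∷ ys) v#w = begin
      #sorted (map (x ∷_) Lx ++ map (y ∷_) Ly)
        ≈⟨ ∑-++ _ (map (x ∷_) Lx) (map (y ∷_) Ly) ⟩
      #sorted (map (x ∷_) Lx) + #sorted (map (y ∷_) Ly)
        ≈⟨ +-cong (#sorted-cons x _ Lx (shuffles-all (x ≺_) xs (y ∷ ys)))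
                  (#sorted-cons y _ Ly (shuffles-all (y ≺_) (x ∷ xs) ys)) ⟩
      𝟙 ax * #sorted Lx + 𝟙 ay * #sorted Ly
        ≈⟨ +-cong (*-congˡ (#sorted-shuffles xs (y ∷ ys) (v#w ∘ there)))
                  (*-congˡ (#sorted-shuffles (x ∷ xs) ys (λ z∈ → v#w z∈ ∘ there))) ⟩
      𝟙 ax * 𝟙 (sorted _≺_ xs ∧ sorted _≺_ (y ∷ ys)) +
        𝟙 ay * 𝟙 (sorted _≺_ (x ∷ xs) ∧ sorted _≺_ ys)
        ≈⟨ ≈-sym (+-cong (𝟙-∧ ax _) (𝟙-∧ ay _)) ⟩
      𝟙 (x-block x xs y ys) + 𝟙 (y-block x xs y ys)
        ≈⟨ one-block (blocks x xs y ys x≢y) ⟩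
      𝟙 (sorted _≺_ (x ∷ xs) ∧ sorted _≺_ (y ∷ ys)) ∎
      where
      Lx Ly : List (List ℕ)
      Lx = shuffles xs (y ∷ ys)
      Ly = shuffles (x ∷ xs) ys
      ax ay : Bool
      ax = all (x ≺_) xs ∧ all (x ≺_) (y ∷ ys)
      ay = all (y ≺_) (x ∷ xs) ∧ all (y ≺_) ys
      x≢y : x ≢ y
      x≢y x≡y = v#w (here refl) (here x≡y)
      one-block : ∀ {b₁ b₂ t} → (b₁ ≡ t × b₂ ≡ false) ⊎ (b₁ ≡ false × b₂ ≡ t) → 𝟙 b₁ + 𝟙 b₂ ≈ 𝟙 t
      one-block (inj₁ (refl , refl)) = +-identityʳ _
      one-block (inj₂ (refl , refl)) = +-identityˡ _

    #sorted-perms : ∀ es → Unique es → #sorted (perms es) ≈ 1#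
    #sorted-perms []       _          = +-identityʳ 1#
    #sorted-perms (a ∷ es) (a∉ ∷ ues) = begin
      #sorted (concatMap (insertions a) (perms es))  ≈⟨ ∑-concatMap _ (insertions a) (perms es) ⟩
      ∑ (λ w → #sorted (insertions a w)) (perms es)  ≈⟨ ∑-cong (perms es) insert ⟩
      #sorted (perms es)                             ≈⟨ #sorted-perms es ues ⟩
      1#                                             ∎
      where
      insert : ∀ {w} → w ∈ perms es → #sorted (insertions a w) ≈ 𝟙 (sorted _≺_ w)
      insert {w} w∈ rewrite insertions≡shuffles a w = #sorted-shuffles (a ∷ []) w
        λ { (here refl) a∈w → lookup a∉ (∈-resp-↭ (perms-↭ es w∈) a∈w) refl }

    #sorted-linExts : ∀ P → #sorted (linExts P) ≈ 𝟙 (compatible? (lt P) _≺_ (elems P))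
    #sorted-linExts P = begin
      #sorted (filterᵇ (respects (lt P)) (perms (elems P)))
        ≈⟨ ∑-filter _ (respects (lt P)) (perms (elems P)) ⟩
      ∑ (λ v → 𝟙 (respects (lt P) v) * 𝟙 (sorted _≺_ v)) (perms (elems P))
        ≈⟨ ∑-cong (perms (elems P)) (λ v∈ → ≈-trans (≈-sym (𝟙-∧ _ _)) (≈-trans
             (≈-reflexive (cong 𝟙
               (linExt-sorted ≺-asym (λ {a} → irrefl P a) (perms-↭ (elems P) v∈))))
             (𝟙-∧ _ _))) ⟩
      ∑ (λ v → 𝟙 P≺ * 𝟙 (sorted _≺_ v)) (perms (elems P))
        ≈⟨ ∑-*ˡ _ _ (perms (elems P)) ⟩
      𝟙 P≺ * #sorted (perms (elems P))
        ≈⟨ *-congˡ (#sorted-perms (elems P) (unique P)) ⟩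
      𝟙 P≺ * 1#
        ≈⟨ *-identityʳ _ ⟩
      𝟙 P≺ ∎
      where
      P≺ : Bool
      P≺ = compatible? (lt P) _≺_ (elems P)

    #sorted-shuffleAll : ∀ Ls Ms → (∀ {v w z} → v ∈ Ls → w ∈ Ms → z ∈ v → z ∉ w) →
      #sorted (shuffleAll Ls Ms) ≈ #sorted Ls * #sorted Ms
    #sorted-shuffleAll Ls Ms disjoint = begin
      #sorted (shuffleAll Ls Ms)
        ≈⟨ ∑-concatMap _ _ Ls ⟩
      ∑ (λ v → #sorted (concatMap (λ w → shuffles v w) Ms)) Ls
        ≈⟨ ∑-cong′ Ls (λ v → ∑-concatMap _ _ Ms) ⟩
      ∑ (λ v → ∑ (λ w → #sorted (shuffles v w)) Ms) Ls
        ≈⟨ ∑-cong Ls (λ v∈ → ∑-cong Ms (λ w∈ → #sorted-shuffles _ _ (disjoint v∈ w∈))) ⟩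
      ∑ (λ v → ∑ (λ w → 𝟙 (sorted _≺_ v ∧ sorted _≺_ w)) Ms) Ls
        ≈⟨ ∑-cong′ Ls (λ v → ≈-trans (∑-cong′ Ms (λ w → 𝟙-∧ _ _)) (∑-*ˡ _ _ Ms)) ⟩
      ∑ (λ v → 𝟙 (sorted _≺_ v) * #sorted Ms) Ls
        ≈⟨ ∑-*ʳ _ _ Ls ⟩
      #sorted Ls * #sorted Ms ∎

  module Assignments (N : ℕ) where

    update : (ℕ → ℤ) → ℕ → ℤ → ℕ → ℤ
    update g a v z = if z ≡ᵇ a then v else g z

    zeroAssignment : ℕ → ℤ
    zeroAssignment _ = + 0

    -- ∑ᶠ es Φ b sums Φ over all ways of changing b on the labels es to
    -- values in ±[N], the first label of es being summed outermost.
    ∑ᶠ : List ℕ → ((ℕ → ℤ) → Carrier) → (ℕ → ℤ) → Carrier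
    ∑ᶠ []       Φ b = Φ b
    ∑ᶠ (a ∷ es) Φ b = ∑ (λ v → ∑ᶠ es (λ g → Φ (update g a v)) b) (vals N)

    DependsOn : List ℕ → ((ℕ → ℤ) → Carrier) → Set _
    DependsOn es Φ = ∀ {f g} → (∀ {z} → z ∈ es → f z ≡ g z) → Φ f ≈ Φ g

    Ignores : List ℕ → ((ℕ → ℤ) → Carrier) → Set _
    Ignores es Φ = ∀ {f g} → (∀ {z} → z ∉ es → f z ≡ g z) → Φ f ≈ Φ g

    Extensional : ((ℕ → ℤ) → Carrier) → Set _
    Extensional Φ = ∀ {f g} → (∀ z → f z ≡ g z) → Φ f ≈ Φ g

    update-Extensional : ∀ {Φ} → Extensional Φ → ∀ a v → Extensional (λ g → Φ (update g a v))
    update-Extensional Φ-ext a v f≗g = Φ-ext (λ z → cong (if z ≡ᵇ a then v else_) (f≗g z))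

    ∑ᶠ-cong : ∀ es {Φ Ψ} → (∀ g → Φ g ≈ Ψ g) → ∀ b → ∑ᶠ es Φ b ≈ ∑ᶠ es Ψ b
    ∑ᶠ-cong []       Φ≈Ψ b = Φ≈Ψ b
    ∑ᶠ-cong (a ∷ es) Φ≈Ψ b = ∑-cong′ (vals N) (λ v → ∑ᶠ-cong es (λ g → Φ≈Ψ (update g a v)) b)

    ∑ᶠ-∑ : ∀ {A : Set} es (Ψ : A → (ℕ → ℤ) → Carrier) L b →
      ∑ (λ i → ∑ᶠ es (Ψ i) b) L ≈ ∑ᶠ es (λ g → ∑ (λ i → Ψ i g) L) b
    ∑ᶠ-∑ []       Ψ L b = ≈-refl
    ∑ᶠ-∑ (a ∷ es) Ψ L b =
      ≈-trans (∑-swap (λ i v → ∑ᶠ es (λ g → Ψ i (update g a v)) b) L (vals N))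
              (∑-cong′ (vals N) (λ v → ∑ᶠ-∑ es (λ i g → Ψ i (update g a v)) L b))

    ∑ᶠ-*ˡ : ∀ es Φ k b → ∑ᶠ es (λ g → k * Φ g) b ≈ k * ∑ᶠ es Φ b
    ∑ᶠ-*ˡ []       Φ k b = ≈-refl
    ∑ᶠ-*ˡ (a ∷ es) Φ k b =
      ≈-trans (∑-cong′ (vals N) (λ v → ∑ᶠ-*ˡ es (λ g → Φ (update g a v)) k b)) (∑-*ˡ k _ (vals N))

    ∑-assigns : ∀ es Φ → ∑ Φ (assigns N es) ≈ ∑ᶠ es Φ zeroAssignment
    ∑-assigns []       Φ = +-identityʳ _
    ∑-assigns (a ∷ es) Φ = begin
      ∑ Φ (concatMap (λ g → map (update g a) (vals N)) (assigns N es))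
        ≈⟨ ∑-concatMap Φ _ (assigns N es) ⟩
      ∑ (λ g → ∑ Φ (map (update g a) (vals N))) (assigns N es)
        ≈⟨ ∑-cong′ (assigns N es) (λ g → ∑-map Φ (update g a) (vals N)) ⟩
      ∑ (λ g → ∑ (λ v → Φ (update g a v)) (vals N)) (assigns N es)
        ≈⟨ ∑-assigns es _ ⟩
      ∑ᶠ es (λ g → ∑ (λ v → Φ (update g a v)) (vals N)) zeroAssignment
        ≈⟨ ≈-sym (∑ᶠ-∑ es (λ v g → Φ (update g a v)) (vals N) zeroAssignment) ⟩
      ∑ᶠ (a ∷ es) Φ zeroAssignment ∎

    ∑ᶠ-↭ : ∀ {Φ} → Extensional Φ → ∀ {es es′} → es ↭ es′ → ∀ b → ∑ᶠ es Φ b ≈ ∑ᶠ es′ Φ b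
    ∑ᶠ-↭ Φ-ext ↭-refl          b = ≈-refl
    ∑ᶠ-↭ Φ-ext (prep a p)      b = ∑-cong′ (vals N) (λ v → ∑ᶠ-↭ (update-Extensional Φ-ext a v) p b)
    ∑ᶠ-↭ Φ-ext (↭-trans p q)   b = ≈-trans (∑ᶠ-↭ Φ-ext p b) (∑ᶠ-↭ Φ-ext q b)
    ∑ᶠ-↭ {Φ} Φ-ext (swap {xs} {ys} a a′ p) b with a ≟ a′
    ... | yes refl = ∑-cong′ (vals N) (λ v → ∑-cong′ (vals N) (λ w →
                       ∑ᶠ-↭ (update-Extensional (update-Extensional Φ-ext a v) a w) p b))
    ... | no a≢a′ = begin
      ∑ (λ v → ∑ (λ w → ∑ᶠ xs (λ g → Φ (update (update g a′ w) a v)) b) (vals N)) (vals N)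
        ≈⟨ ∑-cong′ (vals N) (λ v → ∑-cong′ (vals N) (λ w →
             ∑ᶠ-↭ (update-Extensional (update-Extensional Φ-ext a v) a′ w) p b)) ⟩
      ∑ (λ v → ∑ (λ w → ∑ᶠ ys (λ g → Φ (update (update g a′ w) a v)) b) (vals N)) (vals N)
        ≈⟨ ∑-swap (λ v w → ∑ᶠ ys (λ g → Φ (update (update g a′ w) a v)) b) (vals N) (vals N) ⟩
      ∑ (λ w → ∑ (λ v → ∑ᶠ ys (λ g → Φ (update (update g a′ w) a v)) b) (vals N)) (vals N)
        ≈⟨ ∑-cong′ (vals N) (λ w → ∑-cong′ (vals N) (λ v →
             ∑ᶠ-cong ys (λ g → Φ-ext (update-comm g w v)) b)) ⟩
      ∑ (λ w → ∑ (λ v → ∑ᶠ ys (λ g → Φ (update (update g a v) a′ w)) b) (vals N)) (vals N) ∎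
      where
      update-comm : ∀ g w v z → update (update g a′ w) a v z ≡ update (update g a v) a′ w z
      update-comm g w v z with z ≡ᵇ a in za | z ≡ᵇ a′ in za′
      ... | true  | true  = ⊥-elim (a≢a′ (≡-trans (sym (≡ᵇ-true⇒≡ z a za)) (≡ᵇ-true⇒≡ z a′ za′)))
      ... | true  | false = refl
      ... | false | true  = refl
      ... | false | false = refl

    ∑ᶠ-base : ∀ es {Φ} → DependsOn es Φ → ∀ b b′ → ∑ᶠ es Φ b ≈ ∑ᶠ es Φ b′
    ∑ᶠ-base []       Φ-dep b b′ = Φ-dep (λ ())
    ∑ᶠ-base (a ∷ es) Φ-dep b b′ =
      ∑-cong′ (vals N) (λ v → ∑ᶠ-base es (λ f≐g → Φ-dep (agree v f≐g)) b b′)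
      where
      agree : ∀ {f g} v → (∀ {z} → z ∈ es → f z ≡ g z) →
        ∀ {z} → z ∈ a ∷ es → update f a v z ≡ update g a v z
      agree v f≐g {z} z∈ with z ≡ᵇ a in za
      ... | true = refl
      agree v f≐g (here refl)  | false = ⊥-elim (false≢true (≡-trans (sym za) (≡ᵇ-refl a)))
      agree v f≐g (there z∈es) | false = f≐g z∈es

    ∑ᶠ-++ : ∀ es₁ es₂ Φ b → ∑ᶠ (es₁ ++ es₂) Φ b ≈ ∑ᶠ es₂ (∑ᶠ es₁ Φ) b
    ∑ᶠ-++ []        es₂ Φ b = ≈-refl
    ∑ᶠ-++ (a ∷ es₁) es₂ Φ b =
      ≈-trans (∑-cong′ (vals N) (λ v → ∑ᶠ-++ es₁ es₂ (λ g → Φ (update g a v)) b))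
              (∑ᶠ-∑ es₂ (λ v → ∑ᶠ es₁ (λ g → Φ (update g a v))) (vals N) b)

    ∑ᶠ-frame : ∀ es Φ {Ψ} → Ignores es Ψ → ∀ b → ∑ᶠ es (λ g → Φ g * Ψ g) b ≈ ∑ᶠ es Φ b * Ψ b
    ∑ᶠ-frame []       Φ Ψ-ign b = ≈-refl
    ∑ᶠ-frame (a ∷ es) Φ {Ψ} Ψ-ign b = begin
      ∑ (λ v → ∑ᶠ es (λ g → Φ (update g a v) * Ψ (update g a v)) b) (vals N)
        ≈⟨ ∑-cong′ (vals N) (λ v → ∑ᶠ-frame es _ (λ f≐g → Ψ-ign (agree f≐g)) b) ⟩
      ∑ (λ v → ∑ᶠ es (λ g → Φ (update g a v)) b * Ψ (update b a v)) (vals N)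
        ≈⟨ ∑-cong′ (vals N) (λ v → *-congˡ (Ψ-ign (unchanged v))) ⟩
      ∑ (λ v → ∑ᶠ es (λ g → Φ (update g a v)) b * Ψ b) (vals N)
        ≈⟨ ∑-*ʳ (Ψ b) _ (vals N) ⟩
      ∑ᶠ (a ∷ es) Φ b * Ψ b ∎
      where
      agree : ∀ {f g v} → (∀ {z} → z ∉ es → f z ≡ g z) →
        ∀ {z} → z ∉ a ∷ es → update f a v z ≡ update g a v z
      agree f≐g {z} z∉ with z ≡ᵇ a
      ... | true  = refl
      ... | false = f≐g (z∉ ∘ there)
      unchanged : ∀ v {z} → z ∉ a ∷ es → update b a v z ≡ b z
      unchanged v {z} z∉ with z ≡ᵇ a in za
      ... | true  = ⊥-elim (z∉ (here (≡ᵇ-true⇒≡ z a za)))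
      ... | false = refl

    ∑ᶠ-product : ∀ es₁ es₂ {Φ Ψ} → DependsOn es₁ Φ → Ignores es₁ Ψ → ∀ b →
      ∑ᶠ (es₁ ++ es₂) (λ f → Φ f * Ψ f) b ≈ ∑ᶠ es₁ Φ b * ∑ᶠ es₂ Ψ b
    ∑ᶠ-product es₁ es₂ {Φ} {Ψ} Φ-dep Ψ-ign b = begin
      ∑ᶠ (es₁ ++ es₂) (λ f → Φ f * Ψ f) b  ≈⟨ ∑ᶠ-++ es₁ es₂ _ b ⟩
      ∑ᶠ es₂ (∑ᶠ es₁ (λ f → Φ f * Ψ f)) b  ≈⟨ ∑ᶠ-cong es₂ (∑ᶠ-frame es₁ Φ Ψ-ign) b ⟩
      ∑ᶠ es₂ (λ h → ∑ᶠ es₁ Φ h * Ψ h) b    ≈⟨ ∑ᶠ-cong es₂ (λ h → *-congʳ (∑ᶠ-base es₁ Φ-dep h b)) b ⟩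
      ∑ᶠ es₂ (λ h → ∑ᶠ es₁ Φ b * Ψ h) b    ≈⟨ ∑ᶠ-*ˡ es₂ Ψ _ b ⟩
      ∑ᶠ es₁ Φ b * ∑ᶠ es₂ Ψ b              ∎

module PartitionSums {c ℓ : Level} (𝓡 : CommutativeSemiring c ℓ) (N : ℕ)
  (x : ℕ → CommutativeSemiring.Carrier 𝓡) where
  open CommutativeSemiring 𝓡
    renaming (refl to ≈-refl; sym to ≈-sym; trans to ≈-trans; reflexive to ≈-reflexive)
  open import Relation.Binary.Reasoning.Setoid setoid
  open CommSemigroupProperties *-commutativeSemigroup using () renaming (interchange to *-interchange)
  open Sums 𝓡
  open Assignments N

  term : List ℕ → (ℕ → ℕ → Bool) → List ℕ → (ℕ → ℤ) → Carrier
  term es ρ S f = 𝟙 (isEnriched es ρ f) * weight 𝓡 x S f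

  Λ-∑ᶠ : ∀ es ρ S → Λ 𝓡 N x es ρ S ≈ ∑ᶠ es (term es ρ S) zeroAssignment
  Λ-∑ᶠ es ρ S = ≈-trans (∑-filter (weight 𝓡 x S) (isEnriched es ρ) (assigns N es)) (∑-assigns es _)

  weight-++ : ∀ S T f → weight 𝓡 x (S ++ T) f ≈ weight 𝓡 x S f * weight 𝓡 x T f
  weight-++ []      T f = ≈-sym (*-identityˡ _)
  weight-++ (s ∷ S) T f = ≈-trans (*-congˡ (weight-++ S T f)) (≈-sym (*-assoc _ _ _))

  term-local : ∀ es ρ S {f g} → (∀ {z} → z ∈ es → f z ≡ g z) → (∀ {z} → z ∈ S → f z ≡ g z) →
    term es ρ S f ≈ term es ρ S g
  term-local es ρ S {f} {g} on-es on-S =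
    ≈-reflexive (cong₂ (λ b w → 𝟙 b * w) enriched (weight-local S on-S))
    where
    enriched : isEnriched es ρ f ≡ isEnriched es ρ g
    enriched = all-cong es (λ a∈ → all-cong es (λ b∈ →
      cong₂ (λ u v → not (ρ _ _) ∨ labelledLt _ _ u v) (on-es a∈) (on-es b∈)))
    weight-local : ∀ S → (∀ {z} → z ∈ S → f z ≡ g z) → weight 𝓡 x S f ≡ weight 𝓡 x S g
    weight-local []      _  = refl
    weight-local (s ∷ S) on =
      cong₂ (λ u w → x ∣ u ∣ * w) (on (here refl)) (weight-local S (on ∘ there))

  module ShuffleProduct (P Q : LabeledPoset) (S T : List ℕ)
    (P#Q : All (λ a → a ∉ elems Q) (elems P))
    (S⊆P : All (_∈ elems P) S) (T⊆Q : All (_∈ elems Q) T) where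

    E : List ℕ
    E = elems P ++ elems Q

    W : List (List ℕ)
    W = shuffleAll (linExts P) (linExts Q)

    linExts-↭ : ∀ P′ {v} → v ∈ linExts P′ → v ↭ elems P′
    linExts-↭ P′ v∈ = perms-↭ (elems P′) (proj₁ (∈-filter⁻ (T? ∘ respects (lt P′)) v∈))

    linExts-disjoint : ∀ {v w z} → v ∈ linExts P → w ∈ linExts Q → z ∈ v → z ∉ w
    linExts-disjoint v∈ w∈ z∈v z∈w =
      lookup P#Q (∈-resp-↭ (linExts-↭ P v∈) z∈v) (∈-resp-↭ (linExts-↭ Q w∈) z∈w)

    W-↭ : ∀ {u} → u ∈ W → u ↭ E
    W-↭ u∈ with ∈-shuffleAll⁻ u∈
    ... | v , w , v∈ , w∈ , u∈vw =
      ↭-trans (shuffles-↭ v w u∈vw)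
              (↭-trans (++⁺ʳ w (linExts-↭ P v∈)) (++⁺ˡ (elems P) (linExts-↭ Q w∈)))

    W-unique : ∀ {u} → u ∈ W → Unique u
    W-unique u∈ = Unique-↭ (↭-sym (W-↭ u∈))
      (++⁺ (unique P) (unique Q) λ { (z∈P , z∈Q) → lookup P#Q z∈P z∈Q })

    -- For a fixed assignment f, the words u ∈ W for which f is an enriched
    -- u-partition are counted by [f enriched for P]·[f enriched for Q]: such
    -- u are the sorted words for the order of f (Lemma compatible?-chain).
    enriched-count : ∀ f → ∑ (λ u → 𝟙 (isEnriched u (chainLt u) f)) W ≈
      𝟙 (isEnriched (elems P) (lt P) f) * 𝟙 (isEnriched (elems Q) (lt Q) f)
    enriched-count f = begin
      ∑ (λ u → 𝟙 (isEnriched u (chainLt u) f)) W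
        ≈⟨ ∑-cong W (λ u∈ → ≈-reflexive (cong 𝟙 (compatible?-chain (W-unique u∈)))) ⟩
      #sorted W
        ≈⟨ #sorted-shuffleAll (linExts P) (linExts Q) linExts-disjoint ⟩
      #sorted (linExts P) * #sorted (linExts Q)
        ≈⟨ *-cong (#sorted-linExts P) (#sorted-linExts Q) ⟩
      𝟙 (isEnriched (elems P) (lt P) f) * 𝟙 (isEnriched (elems Q) (lt Q) f) ∎
      where
      open SortedCount (assignOrder f)
        (assignOrder-asym f) (assignOrder-trans f) (assignOrder-total f)

    termP termQ : (ℕ → ℤ) → Carrier
    termP = term (elems P) (lt P) S
    termQ = term (elems Q) (lt Q) T

    termU : List ℕ → (ℕ → ℤ) → Carrier
    termU u = term u (chainLt u) (S ++ T)

    pointwise : ∀ f → ∑ (λ u → termU u f) W ≈ termP f * termQ f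
    pointwise f = begin
      ∑ (λ u → 𝟙 (isEnriched u (chainLt u) f) * weight 𝓡 x (S ++ T) f) W
        ≈⟨ ∑-*ʳ _ _ W ⟩
      ∑ (λ u → 𝟙 (isEnriched u (chainLt u) f)) W * weight 𝓡 x (S ++ T) f
        ≈⟨ *-cong (enriched-count f) (weight-++ S T f) ⟩
      (𝟙 (isEnriched (elems P) (lt P) f) * 𝟙 (isEnriched (elems Q) (lt Q) f)) *
        (weight 𝓡 x S f * weight 𝓡 x T f)
        ≈⟨ *-interchange _ _ _ _ ⟩
      termP f * termQ f ∎

    termP-local : DependsOn (elems P) termP
    termP-local on-P = term-local (elems P) (lt P) S on-P (on-P ∘ lookup S⊆P)

    termQ-ignores-P : Ignores (elems P) termQ
    termQ-ignores-P off-P =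
      term-local (elems Q) (lt Q) T (off-P ∘ Q∉P) (off-P ∘ Q∉P ∘ lookup T⊆Q)
      where
      Q∉P : ∀ {z} → z ∈ elems Q → z ∉ elems P
      Q∉P z∈Q z∈P = lookup P#Q z∈P z∈Q

    Λ-W : ∀ {u} → u ∈ W → Λ 𝓡 N x u (chainLt u) (S ++ T) ≈ ∑ᶠ E (termU u) zeroAssignment
    Λ-W {u} u∈ = ≈-trans (Λ-∑ᶠ u (chainLt u) (S ++ T))
      (∑ᶠ-↭ (λ f≗g → term-local u (chainLt u) (S ++ T) (λ {z} _ → f≗g z) (λ {z} _ → f≗g z))
            (W-↭ u∈) zeroAssignment)

    shuffleSum-W : shuffleSum 𝓡 N x P Q S T ≡ ∑ (λ u → Λ 𝓡 N x u (chainLt u) (S ++ T)) W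
    shuffleSum-W = cong (foldr _+_ 0#)
      (≡-trans (sym (concatMap-map [_] (λ u → Λ 𝓡 N x u (chainLt u) (S ++ T)) W))
               (concatMap-pure (map (λ u → Λ 𝓡 N x u (chainLt u) (S ++ T)) W)))

lemma2p1 : ∀ {c ℓ : Level} (R : CommutativeSemiring c ℓ) (N : ℕ)
    (x : ℕ → CommutativeSemiring.Carrier R)
    (P Q : LabeledPoset) (S T : List ℕ) →
    All (λ a → a ∉ elems Q) (elems P) →
    Unique S → All (λ a → a ∈ elems P) S →
    Unique T → All (λ a → a ∈ elems Q) T →
    CommutativeSemiring._≈_ R
      (CommutativeSemiring._*_ R (Λ R N x (elems P) (lt P) S)
                                 (Λ R N x (elems Q) (lt Q) T))
      (shuffleSum R N x P Q S T)
lemma2p1 R N x P Q S T P#Q _ S⊆P _ T⊆Q = begin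
  Λ R N x (elems P) (lt P) S * Λ R N x (elems Q) (lt Q) T
    ≈⟨ *-cong (Λ-∑ᶠ (elems P) (lt P) S) (Λ-∑ᶠ (elems Q) (lt Q) T) ⟩
  ∑ᶠ (elems P) termP zeroAssignment * ∑ᶠ (elems Q) termQ zeroAssignment
    ≈⟨ ≈-sym (∑ᶠ-product (elems P) (elems Q) termP-local termQ-ignores-P zeroAssignment) ⟩
  ∑ᶠ E (λ f → termP f * termQ f) zeroAssignment
    ≈⟨ ≈-sym (∑ᶠ-cong E pointwise zeroAssignment) ⟩
  ∑ᶠ E (λ f → ∑ (λ u → termU u f) W) zeroAssignment
    ≈⟨ ≈-sym (∑ᶠ-∑ E termU W zeroAssignment) ⟩
  ∑ (λ u → ∑ᶠ E (termU u) zeroAssignment) W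
    ≈⟨ ≈-sym (∑-cong W Λ-W) ⟩
  ∑ (λ u → Λ R N x u (chainLt u) (S ++ T)) W
    ≡⟨ sym shuffleSum-W ⟩
  shuffleSum R N x P Q S T ∎
  where
  open CommutativeSemiring R using (_*_; *-cong; setoid) renaming (sym to ≈-sym)
  open import Relation.Binary.Reasoning.Setoid setoid
  open Sums R using (∑; ∑-cong)
  open Sums.Assignments R N using (∑ᶠ; ∑ᶠ-product; ∑ᶠ-cong; ∑ᶠ-∑; zeroAssignment)
  open PartitionSums R N x
  open ShuffleProduct P Q S T P#Q S⊆P T⊆Q
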